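{- Let $T=RT(a_1,\ldots,a_n)$ be a tree of diameter $4$ which is a lobster, where at least three of the $a_i$ are positive (i.e. $k+l\ge 3$ in the notation of the context). If $T$ has an even number of edges, then $T$ is super edge-graceful.
   Context: A lobster is a tree such that removing all its leaves leaves a caterpillar (a caterpillar being a tree whose removal of leaves leaves a path). For a finite simple graph $G$ with $p$ vertices and $q$ edges, $G$ is super edge-graceful if there is a bijection $f$ from $E(G)$ onto $\{0,\pm1,\ldots,\pm\frac{q-1}{2}\}$ when $q$ is odd, and onto $\{\pm1,\ldots,\pm\frac{q}{2}\}$ when $q$ is even, such that the induced vertex labeling $f^+(v)=\sum_{uv\in E(G)} f(uv)$ is a bijection from $V(G)$ onto $\{0,\pm1,\ldots,\pm\frac{p-1}{2}\}$ when $p$ is odd, and onto $\{\pm1,\ldots,\pm\frac{p}{2}\}$ when $p$ is even. For nonnegative integers $a_1,\ldots,a_n$, $RT(a_1,\ldots,a_n)$ is the rooted tree with root $v_0$, children $v_1,\ldots,v_n$ of $v_0$, where $v_i$ has exactly $a_i$ children, all leaves. Let $j$, $k$, $l$ be respectively the number of indices $i$ with $a_i=0$, with $a_i>0$ even, and with $a_i$ odd, so $n=j+k+l$. Every tree of diameter $4$ is of the form $RT(a_1,\ldots,a_n)$ with $k+l\ge2$. -}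

module Defs where

open import Data.Nat as ℕ using (ℕ; zero; suc; _+_; _/_; _%_; _<?_; _≟_)
open import Data.Integer as ℤ using (ℤ; ∣_∣; 0ℤ)
open import Data.Fin as F using (Fin; toℕ)
open import Data.List using (List; []; _∷_; length; map; upTo; filter; lookup; _++_)
open import Data.Nat.ListAction using (sum)
open import Data.Product using (_×_; _,_; proj₁; proj₂; ∃)
open import Data.Sum using (_⊎_)
open import Relation.Binary.PropositionalEquality using (_≡_; _≢_)
open import Relation.Nullary using (does)
open import Data.Bool using (if_then_else_; _∨_)
open import Function.Definitions using (Injective)

-- A finite (multi)graph: vertices are 0 , … , p-1 (as naturals), edges are
-- an explicit list of unordered pairs of endpoints; q = number of edges.
record Graph : Set where
  field
    p     : ℕ
    edges : List (ℕ × ℕ)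

  q : ℕ
  q = length edges

  edge : Fin q → ℕ × ℕ
  edge = lookup edges

open Graph public

sumFin : (m : ℕ) → (Fin m → ℤ) → ℤ
sumFin zero    g = 0ℤ
sumFin (suc m) g = g F.zero ℤ.+ sumFin m (λ i → g (F.suc i))

incident : ℕ → ℕ × ℕ → Data.Bool.Bool
incident v (x , y) = does (v ≟ x) ∨ does (v ≟ y)

inducedLabel : (G : Graph) → (Fin (q G) → ℤ) → Fin (p G) → ℤ
inducedLabel G f v =
  sumFin (q G) (λ e → if incident (toℕ v) (edge G e) then f e else 0ℤ)

-- The label set for m objects:
--   m odd  : {0, ±1, …, ±(m-1)/2}
--   m even : {±1, …, ±m/2}
LabelSet : ℕ → ℤ → Set
LabelSet m z = (∣ z ∣ ℕ.≤ m / 2) × (m % 2 ≡ 0 → z ≢ 0ℤ)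

BijOntoLabels : (m : ℕ) → (Fin m → ℤ) → Set
BijOntoLabels m g =
  Injective _≡_ _≡_ g
  × (∀ i → LabelSet m (g i))
  × (∀ z → LabelSet m z → ∃ λ i → g i ≡ z)

SuperEdgeGraceful : Graph → Set
SuperEdgeGraceful G =
  ∃ λ (f : Fin (q G) → ℤ) →
    BijOntoLabels (q G) f × BijOntoLabels (p G) (inducedLabel G f)

-- The rooted tree RT(a₁,…,aₙ), given as the list [a₁,…,aₙ].
-- Vertex numbering: root v₀ = 0, vᵢ = i (1 ≤ i ≤ n), leaves numbered
-- consecutively from n+1 (the aᵢ children of vᵢ form a block).
leafEdges : ℕ → ℕ → List ℕ → List (ℕ × ℕ)
leafEdges i c []       = []
leafEdges i c (a ∷ as) =
  map (λ t → (i , c + t)) (upTo a) ++ leafEdges (suc i) (c + a) as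

RT : List ℕ → Graph
RT as = record
  { p     = suc (length as + sum as)
  ; edges = map (λ i → (0 , suc i)) (upTo (length as))
            ++ leafEdges 1 (suc (length as)) as
  }

-- k + l : the number of indices i with aᵢ > 0.
numPositive : List ℕ → ℕ
numPositive as = length (filter (λ a → 0 <? a) as)

-- Super edge-graceful labellings of the diameter-4 trees RT(a₁,…,aₙ) with an even
-- number q = n + Σ aᵢ = 2t of edges.  Call vᵢ an odd or even branch according to aᵢ;
-- with l odd and h even branches and S = Σ ⌊aᵢ/2⌋ we get h = 2P and t = l + P + S.
-- The edge labels form three bands:
--   * ±1, …, ±l: a "spider" gives the root edge of the y-th odd branch the label r y
--     and one of its leaves the label ℓ y, so that the sums v y = r y + ℓ y are
--     distinct, differ from every ℓ, and Σ r is 0 or -l;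
--   * ±(l+1), …, ±(l+P): the root edges of the even branches, in cancelling pairs;
--   * ±(l+P+1), …, ±t: the remaining leaves, in cancelling pairs within each branch.
-- So vᵢ receives v y or its root-edge label, each leaf its edge label, the root Σ r,
-- and these 2t + 1 values are distinct and lie in [-t, t].
module Submission where

open import Defs
open import Data.Bool using (Bool; true; false; if_then_else_)
open import Data.Empty using (⊥-elim)
open import Data.Fin using (Fin; toℕ; fromℕ<; punchOut)
open import Data.Fin.Properties using (toℕ<n; toℕ-injective; toℕ-fromℕ<; punchOut-injective; pigeonhole; any?)
open import Data.Integer as ℤ using (ℤ; +_; -[1+_]; 0ℤ; ∣_∣; _⊖_)
import Data.Integer.Properties as ℤ
open import Data.List using (List; []; _∷_; length; _++_; map; concat; applyUpTo; lookup; zipWith)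
open import Data.List.Membership.Propositional using (_∈_; _∉_)
open import Data.List.Membership.Propositional.Properties using (∈-++⁻; ∈-++⁺ʳ)
open import Data.List.Properties using (length-++; length-map; map-upTo)
open import Data.Nat.ListAction using (sum)
import Data.List.Relation.Unary.All as All
open import Data.List.Relation.Unary.All.Properties using (¬Any⇒All¬)
open import Data.List.Relation.Unary.Any using (here; there)
open import Data.List.Relation.Unary.Unique.Propositional using (Unique; []; _∷_)
open import Data.List.Relation.Unary.Unique.Propositional.Properties using (++⁺)
open import Data.List.Relation.Binary.Disjoint.Propositional using (Disjoint)
open import Data.Nat
  using (ℕ; zero; suc; _+_; _*_; _∸_; _≤_; _<_; z≤n; s≤s; s≤s⁻¹; ⌊_/2⌋; _<?_; _≟_; _/_; _%_)
open import Data.Nat.DivMod using (m≡m%n+[m/n]*n; m%n<n; m*n/n≡m; +-distrib-/; m*n%n≡0; [m+kn]%n≡m%n)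
open import Data.Nat.Divisibility using (_∣_; divides)
open import Data.Nat.Properties
open import Data.Nat.Tactic.RingSolver using (solve-∀)
open import Algebra.Properties.CommutativeSemigroup ℤ.+-commutativeSemigroup
  using () renaming (x∙yz≈y∙xz to ℤ-left-comm)
open import Data.Product using (_×_; _,_; proj₁; proj₂; ∃)
open import Data.Sum using (_⊎_; inj₁; inj₂)
open import Function using (_∘_)
open import Function.Definitions using (Injective)
open import Relation.Binary.PropositionalEquality
open import Relation.Nullary using (¬_; does; yes; no)
open import Relation.Nullary.Decidable using (dec-true; dec-false)

≡-via : ∀ {A : Set} {x y a b : A} → x ≡ a → y ≡ b → x ≡ y → a ≡ b
≡-via refl refl eq = eq

2*suc : ∀ m → 2 * suc m ≡ suc (suc (2 * m))
2*suc m = *-suc 2 m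

data EvenOdd : ℕ → Set where
  even : ∀ u → EvenOdd (2 * u)
  odd  : ∀ u → EvenOdd (suc (2 * u))

evenOdd : ∀ n → EvenOdd n
evenOdd zero = even 0
evenOdd (suc n) with evenOdd n
... | even u = odd u
... | odd u  = subst EvenOdd (2*suc u) (even (suc u))

halving : ∀ n → n ≡ 2 * ⌊ n /2⌋ ⊎ n ≡ suc (2 * ⌊ n /2⌋)
halving zero = inj₁ refl
halving (suc zero) = inj₂ refl
halving (suc (suc n)) with halving n
... | inj₁ e = inj₁ (trans (cong (suc ∘ suc) e) (sym (2*suc ⌊ n /2⌋)))
... | inj₂ e = inj₂ (trans (cong (suc ∘ suc) e) (cong suc (sym (2*suc ⌊ n /2⌋))))

half-< : ∀ {u m} → 2 * u < 2 * m → u < m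
half-< = *-cancelˡ-< 2 _ _

half-<-odd : ∀ {u m} → suc (2 * u) < 2 * m → u < m
half-<-odd lt = half-< (<-trans (n<1+n _) lt)

pair-< : ∀ {u m} → u < m → suc (2 * u) < 2 * m
pair-< {u} lt = ≤-trans (≤-reflexive (sym (2*suc u))) (*-monoʳ-≤ 2 lt)

⊖-cross : ∀ a b a′ b′ → a ⊖ b ≡ a′ ⊖ b′ → a + b′ ≡ a′ + b
⊖-cross a b a′ b′ eq = ℤ.+-injective (begin
  + (a + b′)                 ≡⟨ shift a b b′ ⟨
  a ⊖ b ℤ.+ + (b + b′)        ≡⟨ cong₂ (λ x k → x ℤ.+ + k) eq (+-comm b b′) ⟩
  a′ ⊖ b′ ℤ.+ + (b′ + b)      ≡⟨ shift a′ b′ b ⟩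
  + (a′ + b)                 ∎)
  where
    open ≡-Reasoning
    reorder : ∀ a b b′ → a + (b + b′) ≡ b + (a + b′)
    reorder = solve-∀
    shift : ∀ a b b′ → a ⊖ b ℤ.+ + (b + b′) ≡ + (a + b′)
    shift a b b′ = begin
      a ⊖ b ℤ.+ + (b + b′)       ≡⟨ ℤ.distribˡ-⊖-+-pos (b + b′) a b ⟩
      (a + (b + b′)) ⊖ b         ≡⟨ cong₂ _⊖_ (reorder a b b′) (sym (+-identityʳ b)) ⟩
      (b + (a + b′)) ⊖ (b + 0)   ≡⟨ ℤ.+-cancelˡ-⊖ b (a + b′) 0 ⟩
      + (a + b′)                ∎

parity-clash : ∀ {x y} a b → x ≡ 2 * a → y ≡ suc (2 * b) → x ≢ y
parity-clash a b refl refl = even≢odd a b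

interleave : {A : Set} → (ℕ → A) → (ℕ → A) → ℕ → A
interleave f g zero          = f 0
interleave f g (suc zero)    = g 0
interleave f g (suc (suc n)) = interleave (f ∘ suc) (g ∘ suc) n

interleave-even : ∀ {A : Set} (f g : ℕ → A) u → interleave f g (2 * u) ≡ f u
interleave-even f g zero    = refl
interleave-even f g (suc u) =
  trans (cong (interleave f g) (2*suc u)) (interleave-even (f ∘ suc) (g ∘ suc) u)

interleave-odd : ∀ {A : Set} (f g : ℕ → A) u → interleave f g (suc (2 * u)) ≡ g u
interleave-odd f g zero    = refl
interleave-odd f g (suc u) =
  trans (cong (interleave f g ∘ suc) (2*suc u)) (interleave-odd (f ∘ suc) (g ∘ suc) u)

sumFrom : (ℕ → ℤ) → ℕ → ℕ → ℤ
sumFrom f o zero    = 0ℤ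
sumFrom f o (suc m) = f o ℤ.+ sumFrom f (suc o) m

sumFrom-+ : ∀ f o m k → sumFrom f o (m + k) ≡ sumFrom f o m ℤ.+ sumFrom f (o + m) k
sumFrom-+ f o zero    k =
  trans (cong (λ o′ → sumFrom f o′ k) (sym (+-identityʳ o))) (sym (ℤ.+-identityˡ _))
sumFrom-+ f o (suc m) k = begin
  f o ℤ.+ sumFrom f (suc o) (m + k)
    ≡⟨ cong (λ s → f o ℤ.+ s) (sumFrom-+ f (suc o) m k) ⟩
  f o ℤ.+ (sumFrom f (suc o) m ℤ.+ sumFrom f (suc o + m) k)
    ≡⟨ cong (λ o′ → f o ℤ.+ (sumFrom f (suc o) m ℤ.+ sumFrom f o′ k)) (sym (+-suc o m)) ⟩
  f o ℤ.+ (sumFrom f (suc o) m ℤ.+ sumFrom f (o + suc m) k)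
    ≡⟨ sym (ℤ.+-assoc (f o) _ _) ⟩
  sumFrom f o (suc m) ℤ.+ sumFrom f (o + suc m) k ∎
  where open ≡-Reasoning

sum-interleave : ∀ f g → (∀ u → f u ℤ.+ g u ≡ 0ℤ) →
                 ∀ u m → sumFrom (interleave f g) (2 * u) (2 * m) ≡ 0ℤ
sum-interleave f g cancel u zero    = refl
sum-interleave f g cancel u (suc m) = begin
  sumFrom h (2 * u) (2 * suc m)
    ≡⟨ cong (sumFrom h (2 * u)) (2*suc m) ⟩
  h (2 * u) ℤ.+ (h (suc (2 * u)) ℤ.+ sumFrom h (suc (suc (2 * u))) (2 * m))
    ≡⟨ sym (ℤ.+-assoc (h (2 * u)) _ _) ⟩
  (h (2 * u) ℤ.+ h (suc (2 * u))) ℤ.+ sumFrom h (suc (suc (2 * u))) (2 * m)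
    ≡⟨ cong₂ ℤ._+_ pair (cong (λ o → sumFrom h o (2 * m)) (sym (2*suc u))) ⟩
  0ℤ ℤ.+ sumFrom h (2 * suc u) (2 * m)
    ≡⟨ ℤ.+-identityˡ _ ⟩
  sumFrom h (2 * suc u) (2 * m)
    ≡⟨ sum-interleave f g cancel (suc u) m ⟩
  0ℤ ∎
  where
    open ≡-Reasoning
    h : ℕ → ℤ
    h = interleave f g
    pair : h (2 * u) ℤ.+ h (suc (2 * u)) ≡ 0ℤ
    pair = trans (cong₂ ℤ._+_ (interleave-even f g u) (interleave-odd f g u)) (cancel u)

alt : ℕ → ℕ → ℤ
alt b = interleave (λ u → + suc (b + u)) (λ u → -[1+ b + u ])

alt-even : ∀ b u → alt b (2 * u) ≡ + suc (b + u)
alt-even b = interleave-even _ _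

alt-odd : ∀ b u → alt b (suc (2 * u)) ≡ -[1+ b + u ]
alt-odd b = interleave-odd _ _

alt-injective : ∀ b {e e′} → alt b e ≡ alt b e′ → e ≡ e′
alt-injective b {e} {e′} = go (evenOdd e) (evenOdd e′)
  where
    go : ∀ {e e′} → EvenOdd e → EvenOdd e′ → alt b e ≡ alt b e′ → e ≡ e′
    go (even u) (even u′) eq =
      cong (2 *_) (+-cancelˡ-≡ b u u′ (suc-injective (ℤ.+-injective (≡-via (alt-even b u) (alt-even b u′) eq))))
    go (odd u)  (odd u′)  eq =
      cong (suc ∘ (2 *_)) (+-cancelˡ-≡ b u u′ (ℤ.-[1+-injective (≡-via (alt-odd b u) (alt-odd b u′) eq)))
    go (even u) (odd u′)  eq with ≡-via (alt-even b u) (alt-odd b u′) eq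
    ... | ()
    go (odd u)  (even u′) eq with ≡-via (alt-odd b u) (alt-even b u′) eq
    ... | ()

alt-above : ∀ b e → b < ∣ alt b e ∣
alt-above b e with evenOdd e
... | even u rewrite alt-even b u = s≤s (m≤m+n b u)
... | odd u  rewrite alt-odd b u  = s≤s (m≤m+n b u)

alt-below : ∀ b {e m} → e < 2 * m → ∣ alt b e ∣ ≤ b + m
alt-below b {e} lt with evenOdd e
... | even u rewrite alt-even b u = +-monoʳ-< b (half-< lt)
... | odd u  rewrite alt-odd b u  = +-monoʳ-< b (half-<-odd lt)

small≢alt : ∀ {z} b e → ∣ z ∣ ≤ b → z ≢ alt b e
small≢alt b e le refl = <⇒≱ (alt-above b e) le

alt≢0 : ∀ b e → alt b e ≢ 0ℤ
alt≢0 b e eq = small≢alt b e z≤n (sym eq)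

alt-pair : ∀ b u → alt b (2 * u) ℤ.+ alt b (suc (2 * u)) ≡ 0ℤ
alt-pair b u = trans (cong₂ ℤ._+_ (alt-even b u) (alt-odd b u)) (ℤ.n⊖n≡0 (suc (b + u)))

sum-alt : ∀ b m → sumFrom (alt b) 0 (2 * m) ≡ 0ℤ
sum-alt b = sum-interleave _ _ (λ u → ℤ.n⊖n≡0 (suc (b + u))) 0

trues : List Bool → ℕ
trues []           = 0
trues (true ∷ bs)  = suc (trues bs)
trues (false ∷ bs) = trues bs

falses : List Bool → ℕ
falses []           = 0
falses (true ∷ bs)  = falses bs
falses (false ∷ bs) = suc (falses bs)

trues-++ : ∀ bs cs → trues (bs ++ cs) ≡ trues bs + trues cs
trues-++ []           cs = refl
trues-++ (true ∷ bs)  cs = cong suc (trues-++ bs cs)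
trues-++ (false ∷ bs) cs = trues-++ bs cs

falses-++ : ∀ bs cs → falses (bs ++ cs) ≡ falses bs + falses cs
falses-++ []           cs = refl
falses-++ (true ∷ bs)  cs = falses-++ bs cs
falses-++ (false ∷ bs) cs = cong suc (falses-++ bs cs)

trues+falses : ∀ bs → trues bs + falses bs ≡ length bs
trues+falses []           = refl
trues+falses (true ∷ bs)  = cong suc (trues+falses bs)
trues+falses (false ∷ bs) = trans (+-suc (trues bs) (falses bs)) (cong suc (trues+falses bs))

-- Merging two sequences along a Boolean pattern: the i-th true entry becomes
-- f (o + i) and the i-th false entry becomes g (e + i).  Every label list of the
-- construction has this shape.
module Merge {A : Set} (f g : ℕ → A) where

  merge : ℕ → ℕ → List Bool → List A
  merge o e []           = []
  merge o e (true ∷ bs)  = f o ∷ merge (suc o) e bs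
  merge o e (false ∷ bs) = g e ∷ merge o (suc e) bs

  merge-length : ∀ o e bs → length (merge o e bs) ≡ length bs
  merge-length o e []           = refl
  merge-length o e (true ∷ bs)  = cong suc (merge-length (suc o) e bs)
  merge-length o e (false ∷ bs) = cong suc (merge-length o (suc e) bs)

  merge-++ : ∀ o e bs cs →
             merge o e (bs ++ cs) ≡ merge o e bs ++ merge (o + trues bs) (e + falses bs) cs
  merge-++ o e [] cs = cong₂ (λ o′ e′ → merge o′ e′ cs) (sym (+-identityʳ o)) (sym (+-identityʳ e))
  merge-++ o e (true ∷ bs) cs = cong (f o ∷_) (trans (merge-++ (suc o) e bs cs)
    (cong (λ o′ → merge (suc o) e bs ++ merge o′ (e + falses bs) cs) (sym (+-suc o (trues bs)))))
  merge-++ o e (false ∷ bs) cs = cong (g e ∷_) (trans (merge-++ o (suc e) bs cs)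
    (cong (λ e′ → merge o (suc e) bs ++ merge (o + trues bs) e′ cs) (sym (+-suc e (falses bs)))))

  merge-∈ : ∀ {x} o e bs → x ∈ merge o e bs →
            (∃ λ y → o ≤ y × y < o + trues bs × x ≡ f y) ⊎
            (∃ λ z → e ≤ z × z < e + falses bs × x ≡ g z)
  merge-∈ o e (true ∷ bs) (here refl) =
    inj₁ (o , ≤-refl , ≤-trans (s≤s (m≤m+n o _)) (≤-reflexive (sym (+-suc o _))) , refl)
  merge-∈ o e (true ∷ bs) (there x∈) with merge-∈ (suc o) e bs x∈
  ... | inj₁ (y , o<y , y< , eq) = inj₁ (y , <⇒≤ o<y , ≤-trans y< (≤-reflexive (sym (+-suc o _))) , eq)
  ... | inj₂ found = inj₂ found
  merge-∈ o e (false ∷ bs) (here refl) =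
    inj₂ (e , ≤-refl , ≤-trans (s≤s (m≤m+n e _)) (≤-reflexive (sym (+-suc e _))) , refl)
  merge-∈ o e (false ∷ bs) (there x∈) with merge-∈ o (suc e) bs x∈
  ... | inj₁ found = inj₁ found
  ... | inj₂ (z , e<z , z< , eq) = inj₂ (z , <⇒≤ e<z , ≤-trans z< (≤-reflexive (sym (+-suc e _))) , eq)

  module _ (lf lg : ℕ)
    (f-inj : ∀ {y y′} → y < lf → y′ < lf → f y ≡ f y′ → y ≡ y′)
    (g-inj : ∀ {z z′} → z < lg → z′ < lg → g z ≡ g z′ → z ≡ z′)
    (f≢g   : ∀ {y z} → y < lf → z < lg → f y ≢ g z) where

    merge-unique : ∀ o e bs → o + trues bs ≤ lf → e + falses bs ≤ lg → Unique (merge o e bs)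
    merge-unique o e [] _ _ = []
    merge-unique o e (true ∷ bs) o≤ e≤ = ¬Any⇒All¬ _ fresh ∷ merge-unique (suc o) e bs o≤′ e≤
      where
        o≤′ : suc o + trues bs ≤ lf
        o≤′ = ≤-trans (≤-reflexive (sym (+-suc o _))) o≤
        o<lf : o < lf
        o<lf = ≤-trans (m≤m+n (suc o) _) o≤′
        fresh : f o ∉ merge (suc o) e bs
        fresh x∈ with merge-∈ (suc o) e bs x∈
        ... | inj₁ (y , o<y , y< , eq) = <⇒≢ o<y (f-inj o<lf (<-≤-trans y< o≤′) eq)
        ... | inj₂ (z , _ , z< , eq) = f≢g o<lf (<-≤-trans z< e≤) eq
    merge-unique o e (false ∷ bs) o≤ e≤ = ¬Any⇒All¬ _ fresh ∷ merge-unique o (suc e) bs o≤ e≤′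
      where
        e≤′ : suc e + falses bs ≤ lg
        e≤′ = ≤-trans (≤-reflexive (sym (+-suc e _))) e≤
        e<lg : e < lg
        e<lg = ≤-trans (m≤m+n (suc e) _) e≤′
        fresh : g e ∉ merge o (suc e) bs
        fresh x∈ with merge-∈ o (suc e) bs x∈
        ... | inj₁ (y , _ , y< , eq) = f≢g (<-≤-trans y< o≤) e<lg (sym eq)
        ... | inj₂ (z , e<z , z< , eq) = <⇒≢ e<z (g-inj e<lg (<-≤-trans z< e≤′) eq)

open Merge using (merge; merge-length; merge-++; merge-∈; merge-unique)

Σℤ : List ℤ → ℤ
Σℤ []       = 0ℤ
Σℤ (x ∷ xs) = x ℤ.+ Σℤ xs

merge-sum : ∀ (f g : ℕ → ℤ) o e bs →
            Σℤ (merge f g o e bs) ≡ sumFrom f o (trues bs) ℤ.+ sumFrom g e (falses bs)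
merge-sum f g o e [] = refl
merge-sum f g o e (true ∷ bs) =
  trans (cong (λ s → f o ℤ.+ s) (merge-sum f g (suc o) e bs)) (sym (ℤ.+-assoc (f o) _ _))
merge-sum f g o e (false ∷ bs) =
  trans (cong (λ s → g e ℤ.+ s) (merge-sum f g o (suc e) bs))
        (ℤ-left-comm (g e) (sumFrom f o (trues bs)) (sumFrom g (suc e) (falses bs)))

code : ℤ → ℕ
code (+ zero)  = 0
code (+ suc k) = suc (2 * k)
code -[1+ k ]  = suc (suc (2 * k))

code-injective : ∀ x y → code x ≡ code y → x ≡ y
code-injective (+ zero)  (+ zero)   _  = refl
code-injective (+ suc k) (+ suc k′) eq = cong (+_ ∘ suc) (*-cancelˡ-≡ k k′ 2 (suc-injective eq))
code-injective -[1+ k ]  -[1+ k′ ]  eq = cong -[1+_] (*-cancelˡ-≡ k k′ 2 (suc-injective (suc-injective eq)))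
code-injective (+ suc k) -[1+ k′ ]  eq = ⊥-elim (even≢odd (suc k′) k (sym (trans eq (sym (2*suc k′)))))
code-injective -[1+ k ]  (+ suc k′) eq = ⊥-elim (even≢odd (suc k) k′ (trans (2*suc k) eq))
code-injective (+ zero)  (+ suc k′) ()
code-injective (+ zero)  -[1+ k′ ]  ()
code-injective (+ suc k) (+ zero)   ()
code-injective -[1+ k ]  (+ zero)   ()

code-≤ : ∀ x → code x ≤ 2 * ∣ x ∣
code-≤ (+ zero)  = z≤n
code-≤ (+ suc k) = ≤-trans (n≤1+n _) (≤-reflexive (sym (2*suc k)))
code-≤ -[1+ k ]  = ≤-reflexive (sym (2*suc k))

code-pos : ∀ x → x ≢ 0ℤ → 1 ≤ code x
code-pos (+ zero)  x≢0 = ⊥-elim (x≢0 refl)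
code-pos (+ suc k) _   = s≤s z≤n
code-pos -[1+ k ]  _   = s≤s z≤n

-- The position of z in the enumeration of LabelSet m: its code, shifted down by one
-- when m is even (then 0 is not a label).
slot : ℕ → ℤ → ℕ
slot m z = code z ∸ (1 ∸ m % 2)

m≡m%2+2[m/2] : ∀ m → m ≡ m % 2 + 2 * (m / 2)
m≡m%2+2[m/2] m = trans (m≡m%n+[m/n]*n m 2) (cong (λ k → m % 2 + k) (*-comm (m / 2) 2))

slot-< : ∀ m {z} → LabelSet m z → slot m z < m
slot-< m {z} (∣z∣≤ , even⇒z≢0) with m % 2 in m%2 | m%n<n m 2
... | 0 | _ = begin-strict
  code z ∸ 1      <⟨ ≤-reflexive (trans (+-comm 1 _) (m∸n+n≡m (code-pos z (even⇒z≢0 refl)))) ⟩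
  code z          ≤⟨ code-≤ z ⟩
  2 * ∣ z ∣       ≤⟨ *-monoʳ-≤ 2 ∣z∣≤ ⟩
  2 * (m / 2)     ≡⟨ trans (cong (_+ 2 * (m / 2)) (sym m%2)) (sym (m≡m%2+2[m/2] m)) ⟩
  m               ∎
  where open ≤-Reasoning
... | 1 | _ = begin-strict
  code z          ≤⟨ code-≤ z ⟩
  2 * ∣ z ∣       ≤⟨ *-monoʳ-≤ 2 ∣z∣≤ ⟩
  2 * (m / 2)     <⟨ n<1+n _ ⟩
  1 + 2 * (m / 2) ≡⟨ trans (cong (_+ 2 * (m / 2)) (sym m%2)) (sym (m≡m%2+2[m/2] m)) ⟩
  m               ∎
  where open ≤-Reasoning
... | suc (suc _) | s≤s (s≤s ())

slot-injective : ∀ m {z z′} → LabelSet m z → LabelSet m z′ → slot m z ≡ slot m z′ → z ≡ z′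
slot-injective m {z} {z′} (_ , even⇒z≢0) (_ , even⇒z′≢0) eq with m % 2 in m%2 | m%n<n m 2
... | 0 | _ = code-injective z z′ (begin
  code z          ≡⟨ m∸n+n≡m (code-pos z (even⇒z≢0 refl)) ⟨
  code z ∸ 1 + 1  ≡⟨ cong (_+ 1) eq ⟩
  code z′ ∸ 1 + 1 ≡⟨ m∸n+n≡m (code-pos z′ (even⇒z′≢0 refl)) ⟩
  code z′         ∎)
  where open ≡-Reasoning
... | 1 | _ = code-injective z z′ eq
... | suc (suc _) | s≤s (s≤s ())

-- Pigeonhole: if an injective labelling of m objects by elements of LabelSet m
-- missed a label, the m objects would fit injectively into m - 1 slots.
no-missed-label : ∀ m (g : Fin m → ℤ) → Injective _≡_ _≡_ g → (∀ i → LabelSet m (g i)) →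
                  ∀ {z} → LabelSet m z → ¬ ¬ (∃ λ i → g i ≡ z)
no-missed-label zero     g _     _  (∣z∣≤0 , z≢0) _ = z≢0 refl (ℤ.∣i∣≡0⇒i≡0 (n≤0⇒n≡0 ∣z∣≤0))
no-missed-label (suc m′) g g-inj g∈ {z} z∈ missed =
  let (i , j , i<j , same) = pigeonhole (n<1+n m′) squeeze
  in <-irrefl (cong toℕ (g-inj (slot-injective (suc m′) (g∈ i) (g∈ j)
       (≡-via (toℕ-fromℕ< _) (toℕ-fromℕ< _) (cong toℕ (punchOut-injective (avoid i) (avoid j) same)))))) i<j
  where
    pos : ∀ i → Fin (suc m′)
    pos i = fromℕ< (slot-< (suc m′) (g∈ i))
    pos-z : Fin (suc m′)
    pos-z = fromℕ< (slot-< (suc m′) z∈)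
    avoid : ∀ i → pos-z ≢ pos i
    avoid i e = missed (i , slot-injective (suc m′) (g∈ i) z∈
      (≡-via (toℕ-fromℕ< _) (toℕ-fromℕ< _) (cong toℕ (sym e))))
    squeeze : Fin (suc m′) → Fin m′
    squeeze i = punchOut (avoid i)

bijection-criterion : ∀ m (g : Fin m → ℤ) → Injective _≡_ _≡_ g → (∀ i → LabelSet m (g i)) →
                      BijOntoLabels m g
bijection-criterion m g g-inj g∈ = g-inj , g∈ , onto
  where
    onto : ∀ z → LabelSet m z → ∃ λ i → g i ≡ z
    onto z z∈ with any? (λ i → g i ℤ.≟ z)
    ... | yes found = found
    ... | no missed = ⊥-elim (no-missed-label m g g-inj g∈ z∈ missed)

-- The d-th entry of a list of integers (0 past the end).
at : List ℤ → ℕ → ℤ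
at []       _       = 0ℤ
at (x ∷ xs) zero    = x
at (x ∷ xs) (suc d) = at xs d

at-∈ : ∀ xs {d} → d < length xs → at xs d ∈ xs
at-∈ (x ∷ xs) {zero}  _        = here refl
at-∈ (x ∷ xs) {suc d} (s≤s lt) = there (at-∈ xs lt)

at-++ˡ : ∀ xs ys {d} → d < length xs → at (xs ++ ys) d ≡ at xs d
at-++ˡ (x ∷ xs) ys {zero}  _        = refl
at-++ˡ (x ∷ xs) ys {suc d} (s≤s lt) = at-++ˡ xs ys lt

at-++ʳ : ∀ xs ys d → at (xs ++ ys) (length xs + d) ≡ at ys d
at-++ʳ []       ys d = refl
at-++ʳ (x ∷ xs) ys d = at-++ʳ xs ys d

at-zipWith : ∀ xs ys d → length xs ≡ length ys → at (zipWith ℤ._+_ xs ys) d ≡ at xs d ℤ.+ at ys d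
at-zipWith []       []       d       _  = refl
at-zipWith (x ∷ xs) (y ∷ ys) zero    _  = refl
at-zipWith (x ∷ xs) (y ∷ ys) (suc d) eq = at-zipWith xs ys d (suc-injective eq)

at-injective : ∀ {xs} → Unique xs → ∀ {d d′} → d < length xs → d′ < length xs →
               at xs d ≡ at xs d′ → d ≡ d′
at-injective (_ ∷ _)        {zero}  {zero}   _        _         _  = refl
at-injective (x∉ ∷ _)       {zero}  {suc d′} _        (s≤s lt′) eq = ⊥-elim (All.lookup x∉ (at-∈ _ lt′) eq)
at-injective (x∉ ∷ _)       {suc d} {zero}   (s≤s lt) _         eq = ⊥-elim (All.lookup x∉ (at-∈ _ lt) (sym eq))
at-injective (_ ∷ xs-unique) {suc d} {suc d′} (s≤s lt) (s≤s lt′) eq = cong suc (at-injective xs-unique lt lt′ eq)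

list-bijection : ∀ m (g : Fin m → ℤ) xs → length xs ≡ m → Unique xs →
                 (∀ {x} → x ∈ xs → LabelSet m x) → (∀ i → g i ≡ at xs (toℕ i)) → BijOntoLabels m g
list-bijection m g xs length≡m xs-unique xs⊆ g≡ = bijection-criterion m g g-injective g∈
  where
    position< : ∀ i → toℕ i < length xs
    position< i = subst (toℕ i <_) (sym length≡m) (toℕ<n i)
    g-injective : Injective _≡_ _≡_ g
    g-injective {i} {j} eq =
      toℕ-injective (at-injective xs-unique (position< i) (position< j) (≡-via (g≡ i) (g≡ j) eq))
    g∈ : ∀ i → LabelSet m (g i)
    g∈ i = subst (LabelSet m) (sym (g≡ i)) (xs⊆ (at-∈ xs (position< i)))

star : ℕ → ℕ → ℕ → List (ℕ × ℕ)
star i c zero    = []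
star i c (suc a) = (i , c) ∷ star i (suc c) a

stars : ℕ → ℕ → List ℕ → List (ℕ × ℕ)
stars i c []       = []
stars i c (a ∷ as) = star i c a ++ stars (suc i) (c + a) as

applyUpTo-star : ∀ (g : ℕ → ℕ × ℕ) i c a → (∀ k → g k ≡ (i , c + k)) → applyUpTo g a ≡ star i c a
applyUpTo-star g i c zero    g≡ = refl
applyUpTo-star g i c (suc a) g≡ = cong₂ _∷_ (trans (g≡ 0) (cong (i ,_) (+-identityʳ c)))
  (applyUpTo-star (g ∘ suc) i (suc c) a (λ k → trans (g≡ (suc k)) (cong (i ,_) (+-suc c k))))

edges-RT : ∀ as → edges (RT as) ≡ star 0 1 (length as) ++ stars 1 (suc (length as)) as
edges-RT as = cong₂ _++_ (trans (map-upTo _ (length as)) (applyUpTo-star _ 0 1 (length as) (λ _ → refl)))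
                         (leafEdges-stars 1 (suc (length as)) as)
  where
    leafEdges-stars : ∀ i c as → leafEdges i c as ≡ stars i c as
    leafEdges-stars i c []       = refl
    leafEdges-stars i c (a ∷ as) = cong₂ _++_ (trans (map-upTo _ a) (applyUpTo-star _ i c a (λ _ → refl)))
                                              (leafEdges-stars (suc i) (c + a) as)

length-star : ∀ i c a → length (star i c a) ≡ a
length-star i c zero    = refl
length-star i c (suc a) = cong suc (length-star i (suc c) a)

length-stars : ∀ i c as → length (stars i c as) ≡ sum as
length-stars i c []       = refl
length-stars i c (a ∷ as) =
  trans (length-++ (star i c a)) (cong₂ _+_ (length-star i c a) (length-stars (suc i) (c + a) as))

q-RT : ∀ as → q (RT as) ≡ length as + sum as
q-RT as = begin
  q (RT as)                                                          ≡⟨ cong length (edges-RT as) ⟩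
  length (star 0 1 (length as) ++ stars 1 (suc (length as)) as)     ≡⟨ length-++ (star 0 1 (length as)) ⟩
  length (star 0 1 (length as)) + length (stars 1 (suc (length as)) as)
    ≡⟨ cong₂ _+_ (length-star 0 1 (length as)) (length-stars 1 (suc (length as)) as) ⟩
  length as + sum as                                                 ∎
  where open ≡-Reasoning

mask : ℕ → ℕ × ℕ → ℤ → ℤ
mask w e x = if incident w e then x else 0ℤ

mask-centre : ∀ w y x → mask w (w , y) x ≡ x
mask-centre w y x rewrite dec-true (w ≟ w) refl = refl

mask-leaf : ∀ w y x → mask w (y , w) x ≡ x
mask-leaf w y x rewrite dec-true (w ≟ w) refl with does (w ≟ y)
... | true  = refl
... | false = refl

mask-far : ∀ {w y y′} x → w ≢ y → w ≢ y′ → mask w (y , y′) x ≡ 0ℤ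
mask-far {w} {y} {y′} x w≢y w≢y′ rewrite dec-false (w ≟ y) w≢y | dec-false (w ≟ y′) w≢y′ = refl

incSum : ℕ → List (ℕ × ℕ) → List ℤ → ℤ
incSum w es ls = Σℤ (zipWith (mask w) es ls)

inducedLabel-incSum : ∀ w (es : List (ℕ × ℕ)) ls → length ls ≡ length es →
  sumFin (length es) (λ e → if incident w (lookup es e) then at ls (toℕ e) else 0ℤ) ≡ incSum w es ls
inducedLabel-incSum w []       []       _  = refl
inducedLabel-incSum w (e ∷ es) (x ∷ ls) eq =
  cong (λ s → mask w e x ℤ.+ s) (inducedLabel-incSum w es ls (suc-injective eq))

incSum-++ : ∀ w es es′ ls ls′ → length es ≡ length ls →
            incSum w (es ++ es′) (ls ++ ls′) ≡ incSum w es ls ℤ.+ incSum w es′ ls′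
incSum-++ w []       es′ []       ls′ _  = sym (ℤ.+-identityˡ _)
incSum-++ w (e ∷ es) es′ (x ∷ ls) ls′ eq =
  trans (cong (λ s → mask w e x ℤ.+ s) (incSum-++ w es es′ ls ls′ (suc-injective eq)))
        (sym (ℤ.+-assoc (mask w e x) _ _))

Outside : ℕ → ℕ → ℕ → Set
Outside w i n = w < i ⊎ i + n ≤ w

outside-≢ : ∀ {w i n} → Outside w i (suc n) → w ≢ i
outside-≢ (inj₁ w<i)  refl = <-irrefl refl w<i
outside-≢ (inj₂ i+n≤) refl = m+1+n≰m _ i+n≤

outside-suc : ∀ {w i n} → Outside w i (suc n) → Outside w (suc i) n
outside-suc (inj₁ w<i)  = inj₁ (m<n⇒m<1+n w<i)
outside-suc {i = i} (inj₂ i+n≤) = inj₂ (≤-trans (≤-reflexive (sym (+-suc i _))) i+n≤)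

star-centre : ∀ i c a ls → length ls ≡ a → incSum i (star i c a) ls ≡ Σℤ ls
star-centre i c zero    []       _  = refl
star-centre i c (suc a) (x ∷ ls) eq =
  cong₂ ℤ._+_ (mask-centre i c x) (star-centre i (suc c) a ls (suc-injective eq))

star-far : ∀ {w i} c a ls → w ≢ i → Outside w c a → incSum w (star i c a) ls ≡ 0ℤ
star-far c zero    ls       _   _   = refl
star-far c (suc a) []       _   _   = refl
star-far c (suc a) (x ∷ ls) w≢i out =
  cong₂ ℤ._+_ (mask-far x w≢i (outside-≢ out)) (star-far (suc c) a ls w≢i (outside-suc out))

star-leaf : ∀ i c k a ls → i < c → k < a → length ls ≡ a → incSum (c + k) (star i c a) ls ≡ at ls k
star-leaf i c zero    (suc a) (x ∷ ls) i<c _ eq = trans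
  (cong₂ ℤ._+_ (trans (cong (λ w → mask w (i , c) x) (+-identityʳ c)) (mask-leaf c i x))
               (star-far (suc c) a ls (λ c+0≡i → <-irrefl (sym (trans (sym (+-identityʳ c)) c+0≡i)) i<c)
                         (inj₁ (s≤s (≤-reflexive (+-identityʳ c))))))
  (ℤ.+-identityʳ x)
star-leaf i c (suc k) (suc a) (x ∷ ls) i<c (s≤s k<a) eq = trans
  (cong₂ ℤ._+_ (mask-far x (λ e → <-irrefl (sym e) (<-≤-trans i<c (m≤m+n c (suc k)))) (m+1+n≢m c))
               (trans (cong (λ w → incSum w (star i (suc c) a) ls) (+-suc c k))
                      (star-leaf i (suc c) k a ls (m<n⇒m<1+n i<c) k<a (suc-injective eq))))
  (ℤ.+-identityˡ _)

blockStars : ℕ → ℕ → List (List ℤ) → List (ℕ × ℕ)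
blockStars i c bs = stars i c (map length bs)

blockStars-cons : ∀ w i c b bs → incSum w (blockStars i c (b ∷ bs)) (concat (b ∷ bs))
  ≡ incSum w (star i c (length b)) b ℤ.+ incSum w (blockStars (suc i) (c + length b) bs) (concat bs)
blockStars-cons w i c b bs = incSum-++ w (star i c (length b)) _ b _ (length-star i c (length b))

centre<leaves : ∀ {i c n} → i + suc n ≤ c → i < c
centre<leaves {i} le = ≤-trans (s≤s (m≤m+n i _)) (≤-trans (≤-reflexive (sym (+-suc i _))) le)

next-block : ∀ {i c n} k → i + suc n ≤ c → suc i + n ≤ c + k
next-block {i} k le = ≤-trans (≤-reflexive (sym (+-suc i _))) (≤-trans le (m≤m+n _ k))

stars-far : ∀ {w} i c bs → Outside w i (length bs) → w < c → incSum w (blockStars i c bs) (concat bs) ≡ 0ℤ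
stars-far i c []       _   _   = refl
stars-far {w} i c (b ∷ bs) out w<c = trans (blockStars-cons w i c b bs) (trans
  (cong₂ ℤ._+_ (star-far c (length b) b (outside-≢ out) (inj₁ w<c))
               (stars-far (suc i) (c + length b) bs (outside-suc out) (<-≤-trans w<c (m≤m+n c _))))
  (ℤ.+-identityˡ 0ℤ))

stars-centre : ∀ i c bs d → i + length bs ≤ c → d < length bs →
               incSum (i + d) (blockStars i c bs) (concat bs) ≡ at (map Σℤ bs) d
stars-centre i c (b ∷ bs) zero le _ = trans (blockStars-cons (i + 0) i c b bs) (trans
  (cong₂ ℤ._+_ (trans (cong (λ w → incSum w (star i c (length b)) b) (+-identityʳ i))
                      (star-centre i c (length b) b refl))
               (stars-far (suc i) (c + length b) bs (inj₁ (s≤s (≤-reflexive (+-identityʳ i))))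
                          (<-≤-trans (≤-<-trans (≤-reflexive (+-identityʳ i)) (centre<leaves le)) (m≤m+n c _))))
  (ℤ.+-identityʳ _))
stars-centre i c (b ∷ bs) (suc d) le (s≤s d<) = trans (blockStars-cons (i + suc d) i c b bs) (trans
  (cong₂ ℤ._+_ (star-far c (length b) b (m+1+n≢m i) (inj₁ (<-≤-trans (+-monoʳ-< i (s≤s d<)) le)))
               (trans (cong (λ w → incSum w (blockStars (suc i) (c + length b) bs) (concat bs)) (+-suc i d))
                      (stars-centre (suc i) (c + length b) bs d (next-block (length b) le) d<)))
  (ℤ.+-identityˡ _))

stars-leaf : ∀ i c bs k → i + length bs ≤ c → k < length (concat bs) →
             incSum (c + k) (blockStars i c bs) (concat bs) ≡ at (concat bs) k
stars-leaf i c (b ∷ bs) k le k< with k <? length b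
... | yes k<b = trans (blockStars-cons (c + k) i c b bs) (trans
  (cong₂ ℤ._+_ (star-leaf i c k (length b) b (centre<leaves le) k<b refl)
               (stars-far (suc i) (c + length b) bs (inj₂ (next-block k le)) (+-monoʳ-< c k<b)))
  (trans (ℤ.+-identityʳ _) (sym (at-++ˡ b (concat bs) k<b))))
... | no k≮b = trans (blockStars-cons (c + k) i c b bs) (trans
  (cong₂ ℤ._+_ (star-far c (length b) b (λ e → <-irrefl (sym e) (<-≤-trans (centre<leaves le) (m≤m+n c k)))
                                       (inj₂ (+-monoʳ-≤ c b≤k)))
               (trans (cong (λ w → incSum w (blockStars (suc i) (c + length b) bs) (concat bs)) c+k≡)
                      (stars-leaf (suc i) (c + length b) bs k′ (next-block (length b) le) k′<)))
  (trans (ℤ.+-identityˡ _)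
         (trans (sym (at-++ʳ b (concat bs) k′)) (cong (at (b ++ concat bs)) (m+[n∸m]≡n b≤k)))))
  where
    b≤k : length b ≤ k
    b≤k = ≮⇒≥ k≮b
    k′ : ℕ
    k′ = k ∸ length b
    c+k≡ : c + k ≡ c + length b + k′
    c+k≡ = trans (cong (λ j → c + j) (sym (m+[n∸m]≡n b≤k))) (sym (+-assoc c (length b) k′))
    k′< : k′ < length (concat bs)
    k′< = +-cancelˡ-< (length b) k′ _
            (subst (_< length b + length (concat bs)) (sym (m+[n∸m]≡n b≤k)) (subst (k <_) (length-++ b) k<))

-- The spider: labels for the l odd branches, with T = ⌊l/2⌋.  Odd branch y gets
-- root-edge label r y and spider-leaf label ℓ y, hence vertex label v y = r y + ℓ y:
--   y = 2u   (u < T) :  r = -(2u+1),  ℓ =  2(T-u),  v =  2T - (4u+1)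
--   y = 2u+1 (u < T) :  r =   2u+1,   ℓ = -2(T-u),  v =  (4u+1) - 2T
--   y = 2T           :  r = -(2T+1),  ℓ =   2T+1,   v =  0     (only when l is odd)
-- The r's are odd, the ℓ's even apart from y = 2T, the v's are distinct and odd apart
-- from y = 2T, and everything has absolute value at most l.
module Spider (l : ℕ) where

  T : ℕ
  T = ⌊ l /2⌋

  r : ℕ → ℤ
  r = interleave (λ u → -[1+ 2 * u ]) (λ u → + suc (2 * u))

  W : ℕ → ℕ
  W u = T ∸ suc u

  ℓ-first : ℕ → ℤ
  ℓ-first u = if does (u <? T) then + suc (suc (2 * W u)) else + suc (2 * T)

  ℓ : ℕ → ℤ
  ℓ = interleave ℓ-first (λ u → -[1+ suc (2 * W u) ])

  v : ℕ → ℤ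
  v y = r y ℤ.+ ℓ y

  data Index : ℕ → Set where
    first  : ∀ {u} → u < T → Index (2 * u)
    second : ∀ {u} → u < T → Index (suc (2 * u))
    last   : Index (2 * T)

  2T≤l : 2 * T ≤ l
  2T≤l with halving l
  ... | inj₁ e = ≤-reflexive (sym e)
  ... | inj₂ e = ≤-trans (n≤1+n _) (≤-reflexive (sym e))

  l≤2T+1 : l ≤ suc (2 * T)
  l≤2T+1 with halving l
  ... | inj₁ e = ≤-trans (≤-reflexive e) (n≤1+n _)
  ... | inj₂ e = ≤-reflexive e

  index : ∀ {y} → y < l → Index y
  index {y} y<l with evenOdd y
  ... | odd u  = second (half-< {u} (s≤s⁻¹ (≤-trans y<l l≤2T+1)))
  ... | even u with m≤n⇒m<n∨m≡n (*-cancelˡ-≤ {u} {T} 2 (s≤s⁻¹ (≤-trans y<l l≤2T+1)))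
  ...   | inj₁ u<T = first u<T
  ...   | inj₂ refl = last

  W-injective : ∀ {u u′} → u < T → u′ < T → W u ≡ W u′ → u ≡ u′
  W-injective lt lt′ eq = suc-injective (∸-cancelˡ-≡ lt lt′ eq)

  W+u : ∀ {u} → u < T → W u + suc u ≡ T
  W+u lt = m∸n+n≡m lt

  r-first : ∀ u → r (2 * u) ≡ -[1+ 2 * u ]
  r-first = interleave-even _ _

  r-second : ∀ u → r (suc (2 * u)) ≡ + suc (2 * u)
  r-second = interleave-odd _ _

  ℓ-first-< : ∀ {u} → u < T → ℓ (2 * u) ≡ + suc (suc (2 * W u))
  ℓ-first-< {u} lt rewrite interleave-even ℓ-first (λ u → -[1+ suc (2 * W u) ]) u
                         | dec-true (u <? T) lt = refl

  ℓ-second : ∀ u → ℓ (suc (2 * u)) ≡ -[1+ suc (2 * W u) ]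
  ℓ-second = interleave-odd _ _

  ℓ-last : ℓ (2 * T) ≡ + suc (2 * T)
  ℓ-last rewrite interleave-even ℓ-first (λ u → -[1+ suc (2 * W u) ]) T
               | dec-false (T <? T) (<-irrefl refl) = refl

  2u+2u+1 : ∀ u → 2 * u + suc (2 * u) ≡ suc (4 * u)
  2u+2u+1 = solve-∀

  2u+2W+2 : ∀ {u} → u < T → 2 * u + suc (suc (2 * W u)) ≡ 2 * T
  2u+2W+2 {u} lt = trans (identity u (W u)) (cong (2 *_) (W+u lt))
    where
      identity : ∀ u w → 2 * u + suc (suc (2 * w)) ≡ 2 * (w + suc u)
      identity = solve-∀

  2W+2≤2T : ∀ {u} → u < T → suc (suc (2 * W u)) ≤ 2 * T
  2W+2≤2T {u} lt = ≤-trans (m≤n+m _ (2 * u)) (≤-reflexive (2u+2W+2 lt))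

  4u : ∀ u → 4 * u ≡ 2 * (2 * u)
  4u = solve-∀

  v-first : ∀ {u} → u < T → v (2 * u) ≡ 2 * T ⊖ suc (4 * u)
  v-first {u} lt rewrite r-first u | ℓ-first-< lt = begin
    suc (suc (2 * W u)) ⊖ suc (2 * u)               ≡⟨ ℤ.+-cancelˡ-⊖ (2 * u) _ _ ⟨
    (2 * u + suc (suc (2 * W u))) ⊖ (2 * u + suc (2 * u)) ≡⟨ cong₂ _⊖_ (2u+2W+2 lt) (2u+2u+1 u) ⟩
    2 * T ⊖ suc (4 * u)                            ∎
    where open ≡-Reasoning

  v-second : ∀ {u} → u < T → v (suc (2 * u)) ≡ suc (4 * u) ⊖ 2 * T
  v-second {u} lt rewrite r-second u | ℓ-second u = begin
    suc (2 * u) ⊖ suc (suc (2 * W u))               ≡⟨ ℤ.+-cancelˡ-⊖ (2 * u) _ _ ⟨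
    (2 * u + suc (2 * u)) ⊖ (2 * u + suc (suc (2 * W u))) ≡⟨ cong₂ _⊖_ (2u+2u+1 u) (2u+2W+2 lt) ⟩
    suc (4 * u) ⊖ 2 * T                            ∎
    where open ≡-Reasoning

  v-last : v (2 * T) ≡ 0ℤ
  v-last rewrite r-first T | ℓ-last = ℤ.n⊖n≡0 (suc (2 * T))

  r-injective′ : ∀ {y y′} → Index y → Index y′ → r y ≡ r y′ → y ≡ y′
  r-injective′ (first {u} _)  (first {u′} _)  eq =
    cong (2 *_) (*-cancelˡ-≡ u u′ 2 (ℤ.-[1+-injective (≡-via (r-first u) (r-first u′) eq)))
  r-injective′ (first {u} _)  (second {u′} _) eq with ≡-via (r-first u) (r-second u′) eq
  ... | ()
  r-injective′ (first {u} lt) last            eq =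
    ⊥-elim (<-irrefl (*-cancelˡ-≡ u T 2 (ℤ.-[1+-injective (≡-via (r-first u) (r-first T) eq))) lt)
  r-injective′ (second {u} _) (first {u′} _)  eq with ≡-via (r-second u) (r-first u′) eq
  ... | ()
  r-injective′ (second {u} _) (second {u′} _) eq =
    cong (suc ∘ (2 *_)) (*-cancelˡ-≡ u u′ 2 (suc-injective (ℤ.+-injective (≡-via (r-second u) (r-second u′) eq))))
  r-injective′ (second {u} _) last            eq with ≡-via (r-second u) (r-first T) eq
  ... | ()
  r-injective′ last           (first {u′} lt′) eq = sym (r-injective′ (first lt′) last (sym eq))
  r-injective′ last           (second {u′} _) eq with ≡-via (r-first T) (r-second u′) eq
  ... | ()
  r-injective′ last           last            eq = refl

  ℓ-injective′ : ∀ {y y′} → Index y → Index y′ → ℓ y ≡ ℓ y′ → y ≡ y′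
  ℓ-injective′ (first {u} lt)  (first {u′} lt′)  eq = cong (2 *_) (W-injective lt lt′
    (*-cancelˡ-≡ (W u) (W u′) 2 (suc-injective (suc-injective (ℤ.+-injective
      (≡-via (ℓ-first-< lt) (ℓ-first-< lt′) eq))))))
  ℓ-injective′ (first {u} lt)  (second {u′} _)  eq with ≡-via (ℓ-first-< lt) (ℓ-second u′) eq
  ... | ()
  ℓ-injective′ (first {u} lt)  last             eq =
    ⊥-elim (parity-clash T (W u) refl refl (sym (suc-injective (ℤ.+-injective (≡-via (ℓ-first-< lt) ℓ-last eq)))))
  ℓ-injective′ (second {u} _)  (first {u′} lt′) eq with ≡-via (ℓ-second u) (ℓ-first-< lt′) eq
  ... | ()
  ℓ-injective′ (second {u} lt) (second {u′} lt′) eq = cong (suc ∘ (2 *_)) (W-injective lt lt′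
    (*-cancelˡ-≡ (W u) (W u′) 2 (suc-injective (ℤ.-[1+-injective (≡-via (ℓ-second u) (ℓ-second u′) eq)))))
  ℓ-injective′ (second {u} _)  last             eq with ≡-via (ℓ-second u) ℓ-last eq
  ... | ()
  ℓ-injective′ last            (first lt′)      eq = sym (ℓ-injective′ (first lt′) last (sym eq))
  ℓ-injective′ last            (second {u′} _)  eq with ≡-via ℓ-last (ℓ-second u′) eq
  ... | ()
  ℓ-injective′ last            last             eq = refl

  r≢ℓ′ : ∀ {y y′} → Index y → Index y′ → r y ≢ ℓ y′
  r≢ℓ′ (first {u} _)  (first lt′)      eq with ≡-via (r-first u) (ℓ-first-< lt′) eq
  ... | ()
  r≢ℓ′ (first {u} _)  (second {u′} _) eq =
    parity-clash u (W u′) refl refl (ℤ.-[1+-injective (≡-via (r-first u) (ℓ-second u′) eq))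
  r≢ℓ′ (first {u} _)  last            eq with ≡-via (r-first u) ℓ-last eq
  ... | ()
  r≢ℓ′ (second {u} _) (first {u′} lt′) eq =
    parity-clash u (W u′) refl refl (suc-injective (ℤ.+-injective (≡-via (r-second u) (ℓ-first-< lt′) eq)))
  r≢ℓ′ (second {u} _) (second {u′} _) eq with ≡-via (r-second u) (ℓ-second u′) eq
  ... | ()
  r≢ℓ′ (second {u} lt) last           eq =
    <-irrefl (*-cancelˡ-≡ u T 2 (suc-injective (ℤ.+-injective (≡-via (r-second u) ℓ-last eq)))) lt
  r≢ℓ′ last           (first lt′)     eq with ≡-via (r-first T) (ℓ-first-< lt′) eq
  ... | ()
  r≢ℓ′ last           (second {u′} _) eq =
    parity-clash T (W u′) refl refl (ℤ.-[1+-injective (≡-via (r-first T) (ℓ-second u′) eq))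
  r≢ℓ′ last           last            eq with ≡-via (r-first T) ℓ-last eq
  ... | ()

  -- For v each case becomes, via ⊖-cross, an equation between naturals that is
  -- refuted by parity or solved by cancellation.
  v-injective′ : ∀ {y y′} → Index y → Index y′ → v y ≡ v y′ → y ≡ y′
  v-injective′ (first {u} lt)  (first {u′} lt′)  eq = cong (2 *_) (sym (*-cancelˡ-≡ u′ u 4 (suc-injective
    (+-cancelˡ-≡ (2 * T) _ _
      (⊖-cross (2 * T) (suc (4 * u)) (2 * T) (suc (4 * u′)) (≡-via (v-first lt) (v-first lt′) eq))))))
  v-injective′ (first {u} lt)  (second {u′} lt′) eq =
    ⊥-elim (4T≢4u+4u′+2 u u′
      (⊖-cross (2 * T) (suc (4 * u)) (suc (4 * u′)) (2 * T) (≡-via (v-first lt) (v-second lt′) eq)))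
    where
      4T≢4u+4u′+2 : ∀ u u′ → 2 * T + 2 * T ≢ suc (4 * u′) + suc (4 * u)
      4T≢4u+4u′+2 u u′ e = even≢odd T (u′ + u) (*-cancelˡ-≡ (2 * T) (suc (2 * (u′ + u))) 2
        (trans (trans (double T) e) (pair u u′)))
        where
          double : ∀ T → 2 * (2 * T) ≡ 2 * T + 2 * T
          double = solve-∀
          pair : ∀ u u′ → suc (4 * u′) + suc (4 * u) ≡ 2 * suc (2 * (u′ + u))
          pair = solve-∀
  v-injective′ (first {u} lt)  last              eq = ⊥-elim (parity-clash T (2 * u) (+-identityʳ _) (cong suc (4u u))
    (⊖-cross (2 * T) (suc (4 * u)) 0 0 (≡-via (v-first lt) v-last eq)))
  v-injective′ (second {u} lt) (first {u′} lt′)  eq = sym (v-injective′ (first lt′) (second lt) (sym eq))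
  v-injective′ (second {u} lt) (second {u′} lt′) eq = cong (suc ∘ (2 *_)) (*-cancelˡ-≡ u u′ 4 (suc-injective
    (+-cancelʳ-≡ (2 * T) _ _
      (⊖-cross (suc (4 * u)) (2 * T) (suc (4 * u′)) (2 * T) (≡-via (v-second lt) (v-second lt′) eq)))))
  v-injective′ (second {u} lt) last              eq =
    ⊥-elim (parity-clash T (2 * u) refl (cong suc (trans (+-identityʳ _) (4u u)))
    (sym (⊖-cross (suc (4 * u)) (2 * T) 0 0 (≡-via (v-second lt) v-last eq))))
  v-injective′ last            (first lt′)       eq = sym (v-injective′ (first lt′) last (sym eq))
  v-injective′ last            (second lt′)      eq = sym (v-injective′ (second lt′) last (sym eq))
  v-injective′ last            last              eq = refl

  v≢ℓ′ : ∀ {y y′} → Index y → Index y′ → v y ≢ ℓ y′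
  v≢ℓ′ (first {u} lt)  (first {u′} lt′)  eq =
    parity-clash T (suc (W u′) + 2 * u) (+-identityʳ _) (odd₁ (W u′) u)
    (⊖-cross (2 * T) (suc (4 * u)) (suc (suc (2 * W u′))) 0 (≡-via (v-first lt) (ℓ-first-< lt′) eq))
    where
      odd₁ : ∀ w u → suc (suc (2 * w)) + suc (4 * u) ≡ suc (2 * (suc w + 2 * u))
      odd₁ = solve-∀
  v≢ℓ′ (first {u} lt)  (second {u′} _)   eq =
    parity-clash (T + suc (W u′)) (2 * u) (even₁ T (W u′)) (cong suc (4u u))
    (⊖-cross (2 * T) (suc (4 * u)) 0 (suc (suc (2 * W u′))) (≡-via (v-first lt) (ℓ-second u′) eq))
    where
      even₁ : ∀ T w → 2 * T + suc (suc (2 * w)) ≡ 2 * (T + suc w)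
      even₁ = solve-∀
  v≢ℓ′ (first {u} lt)  last              eq = 0≢1+n (+-cancelˡ-≡ (2 * T) 0 (suc (suc (4 * u)))
    (trans (⊖-cross (2 * T) (suc (4 * u)) (suc (2 * T)) 0 (≡-via (v-first lt) ℓ-last eq)) (shuffle T u)))
    where
      shuffle : ∀ T u → suc (2 * T) + suc (4 * u) ≡ 2 * T + suc (suc (4 * u))
      shuffle = solve-∀
  v≢ℓ′ (second {u} lt) (first {u′} lt′)  eq =
    parity-clash (suc (W u′) + T) (2 * u) (even₂ T (W u′)) (cong suc (trans (+-identityʳ _) (4u u)))
    (sym (⊖-cross (suc (4 * u)) (2 * T) (suc (suc (2 * W u′))) 0 (≡-via (v-second lt) (ℓ-first-< lt′) eq)))
    where
      even₂ : ∀ T w → suc (suc (2 * w)) + 2 * T ≡ 2 * (suc w + T)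
      even₂ = solve-∀
  v≢ℓ′ (second {u} lt) (second {u′} _)   eq = parity-clash T (2 * u + suc (W u′)) refl (odd₂ (W u′) u)
    (sym (⊖-cross (suc (4 * u)) (2 * T) 0 (suc (suc (2 * W u′))) (≡-via (v-second lt) (ℓ-second u′) eq)))
    where
      odd₂ : ∀ w u → suc (4 * u) + suc (suc (2 * w)) ≡ suc (2 * (2 * u + suc w))
      odd₂ = solve-∀
  v≢ℓ′ (second {u} lt) last              eq = <-irrefl (*-cancelˡ-≡ u T 4 (suc-injective (trans (sym (+-identityʳ _))
    (trans (⊖-cross (suc (4 * u)) (2 * T) (suc (2 * T)) 0 (≡-via (v-second lt) ℓ-last eq)) (4T+1 T))))) lt
    where
      4T+1 : ∀ T → suc (2 * T) + 2 * T ≡ suc (4 * T)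
      4T+1 = solve-∀
  v≢ℓ′ last            (first lt′)       eq with ℤ.+-injective (≡-via v-last (ℓ-first-< lt′) eq)
  ... | ()
  v≢ℓ′ last            (second {u′} _)   eq with ≡-via v-last (ℓ-second u′) eq
  ... | ()
  v≢ℓ′ last            last              eq with ℤ.+-injective (≡-via v-last ℓ-last eq)
  ... | ()

  ∣r∣≤1+y : ∀ y → ∣ r y ∣ ≤ suc y
  ∣r∣≤1+y y with evenOdd y
  ... | even u rewrite r-first u  = ≤-refl
  ... | odd u  rewrite r-second u = n≤1+n _

  ∣ℓ∣≤l′ : ∀ {y} → Index y → y < l → ∣ ℓ y ∣ ≤ l
  ∣ℓ∣≤l′ (first lt)      _   rewrite ℓ-first-< lt = ≤-trans (2W+2≤2T lt) 2T≤l
  ∣ℓ∣≤l′ (second {u} lt) _   rewrite ℓ-second u   = ≤-trans (2W+2≤2T lt) 2T≤l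
  ∣ℓ∣≤l′ last            y<l rewrite ℓ-last       = y<l

  ∣v∣≤2T : ∀ {y} → Index y → ∣ v y ∣ ≤ 2 * T
  ∣v∣≤2T (first {u} lt) rewrite r-first u | ℓ-first-< lt =
    ≤-trans (ℤ.∣m⊝n∣≤m⊔n (suc (suc (2 * W u))) (suc (2 * u))) (⊔-lub (2W+2≤2T lt) (<⇒≤ (pair-< lt)))
  ∣v∣≤2T (second {u} lt) rewrite r-second u | ℓ-second u =
    ≤-trans (ℤ.∣m⊝n∣≤m⊔n (suc (2 * u)) (suc (suc (2 * W u)))) (⊔-lub (<⇒≤ (pair-< lt)) (2W+2≤2T lt))
  ∣v∣≤2T last rewrite v-last = z≤n

  r≢0 : ∀ y → r y ≢ 0ℤ
  r≢0 y eq with evenOdd y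
  ... | even u with ≡-via (r-first u) refl eq
  ...   | ()
  r≢0 y eq | odd u with ≡-via (r-second u) refl eq
  ...   | ()

  ℓ≢0′ : ∀ {y} → Index y → ℓ y ≢ 0ℤ
  ℓ≢0′ (first lt)      eq with ≡-via (ℓ-first-< lt) refl eq
  ... | ()
  ℓ≢0′ (second {u} lt) eq with ≡-via (ℓ-second u) refl eq
  ... | ()
  ℓ≢0′ last            eq with ≡-via ℓ-last refl eq
  ... | ()

  -- The root of the tree receives Σ_{y<l} r y: 0 if l is even, -(2T+1) if l is odd.
  root : ℤ
  root = sumFrom r 0 l

  -- Consecutive pairs of root-edge labels cancel.
  sum-r : ∀ m → sumFrom r 0 (2 * m) ≡ 0ℤ
  sum-r = sum-interleave _ _ (λ u → ℤ.n⊖n≡0 (suc (2 * u))) 0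

  root-value : (l ≡ 2 * T × root ≡ 0ℤ) ⊎ (l ≡ suc (2 * T) × root ≡ -[1+ 2 * T ])
  root-value with halving l
  ... | inj₁ e = inj₁ (e , trans (cong (sumFrom r 0) e) (sum-r T))
  ... | inj₂ e = inj₂ (e , (begin
    sumFrom r 0 l                         ≡⟨ cong (sumFrom r 0) (trans e (+-comm 1 (2 * T))) ⟩
    sumFrom r 0 (2 * T + 1)               ≡⟨ sumFrom-+ r 0 (2 * T) 1 ⟩
    sumFrom r 0 (2 * T) ℤ.+ (r (2 * T) ℤ.+ 0ℤ)
      ≡⟨ cong₂ ℤ._+_ (sum-r T) (trans (ℤ.+-identityʳ _) (r-first T)) ⟩
    0ℤ ℤ.+ -[1+ 2 * T ]                    ≡⟨ ℤ.+-identityˡ _ ⟩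
    -[1+ 2 * T ]                          ∎))
    where open ≡-Reasoning

  module _ {y y′ : ℕ} (y<l : y < l) (y′<l : y′ < l) where

    r-injective : r y ≡ r y′ → y ≡ y′
    r-injective = r-injective′ (index y<l) (index y′<l)

    ℓ-injective : ℓ y ≡ ℓ y′ → y ≡ y′
    ℓ-injective = ℓ-injective′ (index y<l) (index y′<l)

    v-injective : v y ≡ v y′ → y ≡ y′
    v-injective = v-injective′ (index y<l) (index y′<l)

    r≢ℓ : r y ≢ ℓ y′
    r≢ℓ = r≢ℓ′ (index y<l) (index y′<l)

    v≢ℓ : v y ≢ ℓ y′
    v≢ℓ = v≢ℓ′ (index y<l) (index y′<l)

  module _ {y : ℕ} (y<l : y < l) where

    ∣r∣≤l : ∣ r y ∣ ≤ l
    ∣r∣≤l = ≤-trans (∣r∣≤1+y y) y<l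

    ∣ℓ∣≤l : ∣ ℓ y ∣ ≤ l
    ∣ℓ∣≤l = ∣ℓ∣≤l′ (index y<l) y<l

    ∣v∣≤l : ∣ v y ∣ ≤ l
    ∣v∣≤l = ≤-trans (∣v∣≤2T (index y<l)) 2T≤l

    ℓ≢0 : ℓ y ≢ 0ℤ
    ℓ≢0 = ℓ≢0′ (index y<l)

    root≢v : root ≢ v y
    root≢v eq with root-value
    ... | inj₁ (l≡2T , root≡0) =
      <-irrefl (v-injective′ (index y<l) last (trans (sym eq) (trans root≡0 (sym v-last))))
               (≤-trans y<l (≤-reflexive l≡2T))
    ... | inj₂ (_ , root≡) =
      <⇒≱ (n<1+n (2 * T)) (≤-trans (≤-reflexive (cong ∣_∣ (trans (sym root≡) eq))) (∣v∣≤2T (index y<l)))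

    root≢ℓ : root ≢ ℓ y
    root≢ℓ eq with root-value
    ... | inj₁ (_ , root≡0) = ℓ≢0 (trans (sym eq) root≡0)
    ... | inj₂ (_ , root≡) = odd-root (index y<l) (trans (sym eq) root≡)
      where
        odd-root : ∀ {y} → Index y → ℓ y ≢ -[1+ 2 * T ]
        odd-root (first lt)      e with ≡-via (ℓ-first-< lt) refl e
        ... | ()
        odd-root (second {u} _)  e = parity-clash T (W u) refl refl (sym (ℤ.-[1+-injective (≡-via (ℓ-second u) refl e)))
        odd-root last            e with ≡-via ℓ-last refl e
        ... | ()

  ∣root∣≤l : ∣ root ∣ ≤ l
  ∣root∣≤l with root-value
  ... | inj₁ (_ , root≡0) rewrite root≡0 = z≤n
  ... | inj₂ (l≡ , root≡) rewrite root≡ = ≤-reflexive (sym l≡)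

isOdd : ℕ → Bool
isOdd zero          = false
isOdd (suc zero)    = true
isOdd (suc (suc a)) = isOdd a

-- The leaves of a branch with a leaves: ⌊a/2⌋ cancelling pairs (false), followed,
-- when a is odd, by the spider leaf (true).
leafPattern : ℕ → List Bool
leafPattern zero          = []
leafPattern (suc zero)    = true ∷ []
leafPattern (suc (suc a)) = false ∷ false ∷ leafPattern a

nextOdd : ℕ → ℕ → ℕ
nextOdd a o = if isOdd a then suc o else o

length-leafPattern : ∀ a → length (leafPattern a) ≡ a
length-leafPattern zero          = refl
length-leafPattern (suc zero)    = refl
length-leafPattern (suc (suc a)) = cong (suc ∘ suc) (length-leafPattern a)

trues-leafPattern : ∀ a → trues (leafPattern a) ≡ trues (isOdd a ∷ [])
trues-leafPattern zero          = refl
trues-leafPattern (suc zero)    = refl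
trues-leafPattern (suc (suc a)) = trues-leafPattern a

nextOdd-+ : ∀ a o → o + trues (isOdd a ∷ []) ≡ nextOdd a o
nextOdd-+ a o with isOdd a
... | true  = +-comm o 1
... | false = +-identityʳ o

falses-leafPattern : ∀ a K → 2 * K + falses (leafPattern a) ≡ 2 * (K + ⌊ a /2⌋)
falses-leafPattern zero          K = trans (+-identityʳ _) (cong (2 *_) (sym (+-identityʳ K)))
falses-leafPattern (suc zero)    K = trans (+-identityʳ _) (cong (2 *_) (sym (+-identityʳ K)))
falses-leafPattern (suc (suc a)) K =
  trans (shift K _) (trans (falses-leafPattern a (suc K)) (cong (2 *_) (sym (+-suc K _))))
  where
    shift : ∀ K f → 2 * K + suc (suc f) ≡ 2 * suc K + f
    shift = solve-∀

leafPatterns : List ℕ → List Bool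
leafPatterns as = concat (map leafPattern as)

pairs : List ℕ → ℕ
pairs as = sum (map ⌊_/2⌋ as)

trues-leafPatterns : ∀ as → trues (leafPatterns as) ≡ trues (map isOdd as)
trues-leafPatterns []       = refl
trues-leafPatterns (a ∷ as) = trans (trues-++ (leafPattern a) (leafPatterns as))
  (trans (cong₂ _+_ (trues-leafPattern a) (trues-leafPatterns as)) (sym (trues-++ (isOdd a ∷ []) (map isOdd as))))

falses-leafPatterns : ∀ as → falses (leafPatterns as) ≡ 2 * pairs as
falses-leafPatterns []       = refl
falses-leafPatterns (a ∷ as) = trans (falses-++ (leafPattern a) (leafPatterns as))
  (trans (cong₂ _+_ (falses-leafPattern a 0) (falses-leafPatterns as)) (sym (*-distribˡ-+ 2 ⌊ a /2⌋ (pairs as))))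

length-leafPatterns : ∀ as → length (leafPatterns as) ≡ sum as
length-leafPatterns []       = refl
length-leafPatterns (a ∷ as) =
  trans (length-++ (leafPattern a)) (cong₂ _+_ (length-leafPattern a) (length-leafPatterns as))

module Labelling (as : List ℕ) (t : ℕ) (q≡2t : length as + sum as ≡ t * 2) where

  n : ℕ
  n = length as

  oddPattern : List Bool
  oddPattern = map isOdd as

  l h S P : ℕ
  l = trues oddPattern
  h = falses oddPattern
  S = pairs as
  P = t ∸ (l + S)

  open Spider l

  -- The three bands of edge labels: spider labels in [-l, l], root edges of even
  -- branches in ±(l, l + P], cancelling leaf pairs in ±(l + P, l + P + S].
  evenLabel pairLabel : ℕ → ℤ
  evenLabel = alt l
  pairLabel = alt (l + P)

  leafRun : ℕ → ℕ → List Bool → List ℤ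
  leafRun = merge ℓ pairLabel

  rootEdgeLabels leafLabels branchLabels edgeLabels vertexLabels : List ℤ
  rootEdgeLabels = merge r evenLabel 0 0 oddPattern
  leafLabels     = leafRun 0 0 (leafPatterns as)
  branchLabels   = merge v evenLabel 0 0 oddPattern
  -- edges in the order of edges (RT as), vertices in the order 0, 1, …, p - 1
  edgeLabels     = rootEdgeLabels ++ leafLabels
  vertexLabels   = Σℤ rootEdgeLabels ∷ branchLabels ++ leafLabels

  n≡l+h : n ≡ l + h
  n≡l+h = sym (trans (trues+falses oddPattern) (length-map isOdd as))

  sum≡l+2S : sum as ≡ l + 2 * S
  sum≡l+2S = begin
    sum as                                              ≡⟨ length-leafPatterns as ⟨
    length (leafPatterns as)                            ≡⟨ trues+falses (leafPatterns as) ⟨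
    trues (leafPatterns as) + falses (leafPatterns as)  ≡⟨ cong₂ _+_ (trues-leafPatterns as) (falses-leafPatterns as) ⟩
    l + 2 * S                                           ∎
    where open ≡-Reasoning

  h+2[l+S]≡2t : h + 2 * (l + S) ≡ 2 * t
  h+2[l+S]≡2t = trans (rearrange l h S) (trans (cong₂ _+_ (sym n≡l+h) (sym sum≡l+2S)) (trans q≡2t (*-comm t 2)))
    where
      rearrange : ∀ l h S → h + 2 * (l + S) ≡ (l + h) + (l + 2 * S)
      rearrange = solve-∀

  l+S≤t : l + S ≤ t
  l+S≤t = *-cancelˡ-≤ 2 (≤-trans (m≤n+m (2 * (l + S)) h) (≤-reflexive h+2[l+S]≡2t))

  h≡2P : h ≡ 2 * P
  h≡2P = begin
    h                           ≡⟨ m+n∸n≡m h (2 * (l + S)) ⟨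
    h + 2 * (l + S) ∸ 2 * (l + S) ≡⟨ cong (_∸ 2 * (l + S)) h+2[l+S]≡2t ⟩
    2 * t ∸ 2 * (l + S)           ≡⟨ *-distribˡ-∸ 2 t (l + S) ⟨
    2 * P                       ∎
    where open ≡-Reasoning

  t≡l+P+S : t ≡ l + P + S
  t≡l+P+S = trans (sym (m+[n∸m]≡n l+S≤t)) (rearrange l S P)
    where
      rearrange : ∀ l S P → l + S + P ≡ l + P + S
      rearrange = solve-∀

  -- The leaf labels grouped by branch; o and 2K count the odd branches and the
  -- leaf pairs of the earlier branches.
  blocks : ℕ → ℕ → List ℕ → List (List ℤ)
  blocks o K []       = []
  blocks o K (a ∷ bs) = leafRun o (2 * K) (leafPattern a) ∷ blocks (nextOdd a o) (K + ⌊ a /2⌋) bs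

  concat-blocks : ∀ o K bs → concat (blocks o K bs) ≡ leafRun o (2 * K) (leafPatterns bs)
  concat-blocks o K []       = refl
  concat-blocks o K (a ∷ bs) = begin
    leafRun o (2 * K) (leafPattern a) ++ concat (blocks (nextOdd a o) (K + ⌊ a /2⌋) bs)
      ≡⟨ cong (leafRun o (2 * K) (leafPattern a) ++_) (concat-blocks (nextOdd a o) (K + ⌊ a /2⌋) bs) ⟩
    leafRun o (2 * K) (leafPattern a) ++ leafRun (nextOdd a o) (2 * (K + ⌊ a /2⌋)) (leafPatterns bs)
      ≡⟨ cong₂ (λ o′ k′ → leafRun o (2 * K) (leafPattern a) ++ leafRun o′ k′ (leafPatterns bs))
               (sym (trans (cong (λ k → o + k) (trues-leafPattern a)) (nextOdd-+ a o))) (sym (falses-leafPattern a K)) ⟩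
    leafRun o (2 * K) (leafPattern a) ++
      leafRun (o + trues (leafPattern a)) (2 * K + falses (leafPattern a)) (leafPatterns bs)
      ≡⟨ merge-++ ℓ pairLabel o (2 * K) (leafPattern a) (leafPatterns bs) ⟨
    leafRun o (2 * K) (leafPatterns (a ∷ bs)) ∎
    where open ≡-Reasoning

  length-blocks : ∀ o K bs → map length (blocks o K bs) ≡ bs
  length-blocks o K []       = refl
  length-blocks o K (a ∷ bs) =
    cong₂ _∷_ (trans (merge-length ℓ pairLabel o (2 * K) (leafPattern a)) (length-leafPattern a))
                                         (length-blocks (nextOdd a o) (K + ⌊ a /2⌋) bs)

  -- The leaf pairs of a branch cancel; only the spider leaf of an odd branch counts.
  block-sum : ∀ a o K → Σℤ (leafRun o (2 * K) (leafPattern a)) ≡ (if isOdd a then ℓ o else 0ℤ)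
  block-sum zero          o K = refl
  block-sum (suc zero)    o K = ℤ.+-identityʳ (ℓ o)
  block-sum (suc (suc a)) o K = begin
    pairLabel (2 * K) ℤ.+ (pairLabel (suc (2 * K)) ℤ.+ Σℤ (leafRun o (suc (suc (2 * K))) (leafPattern a)))
      ≡⟨ sym (ℤ.+-assoc (pairLabel (2 * K)) _ _) ⟩
    (pairLabel (2 * K) ℤ.+ pairLabel (suc (2 * K))) ℤ.+ Σℤ (leafRun o (suc (suc (2 * K))) (leafPattern a))
      ≡⟨ cong₂ ℤ._+_ (alt-pair (l + P) K) (cong (λ k → Σℤ (leafRun o k (leafPattern a))) (sym (2*suc K))) ⟩
    0ℤ ℤ.+ Σℤ (leafRun o (2 * suc K) (leafPattern a))
      ≡⟨ ℤ.+-identityˡ _ ⟩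
    Σℤ (leafRun o (2 * suc K) (leafPattern a))
      ≡⟨ block-sum a o (suc K) ⟩
    (if isOdd a then ℓ o else 0ℤ) ∎
    where open ≡-Reasoning

  -- A branch vertex receives its root-edge label plus the sum of its leaf labels.
  branchLabels-sum : ∀ o e K bs → merge v evenLabel o e (map isOdd bs)
                   ≡ zipWith ℤ._+_ (merge r evenLabel o e (map isOdd bs)) (map Σℤ (blocks o K bs))
  branchLabels-sum o e K []       = refl
  branchLabels-sum o e K (a ∷ bs) = step (isOdd a) (block-sum a o K)
    where
      step : ∀ b → Σℤ (leafRun o (2 * K) (leafPattern a)) ≡ (if b then ℓ o else 0ℤ) →
             merge v evenLabel o e (b ∷ map isOdd bs)
             ≡ zipWith ℤ._+_ (merge r evenLabel o e (b ∷ map isOdd bs))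
                 (Σℤ (leafRun o (2 * K) (leafPattern a)) ∷ map Σℤ (blocks (if b then suc o else o) (K + ⌊ a /2⌋) bs))
      step true  eq = cong₂ _∷_ (cong (λ s → r o ℤ.+ s) (sym eq)) (branchLabels-sum (suc o) e (K + ⌊ a /2⌋) bs)
      step false eq = cong₂ _∷_ (sym (trans (cong (λ s → evenLabel e ℤ.+ s) eq) (ℤ.+-identityʳ _)))
                                (branchLabels-sum o (suc e) (K + ⌊ a /2⌋) bs)

  -- The root receives the spider root value: the even-branch labels cancel in pairs.
  rootLabel : Σℤ rootEdgeLabels ≡ root
  rootLabel = begin
    Σℤ rootEdgeLabels                              ≡⟨ merge-sum r evenLabel 0 0 oddPattern ⟩
    sumFrom r 0 l ℤ.+ sumFrom evenLabel 0 h        ≡⟨ cong (λ k → root ℤ.+ sumFrom evenLabel 0 k) h≡2P ⟩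
    root ℤ.+ sumFrom evenLabel 0 (2 * P)           ≡⟨ cong (λ s → root ℤ.+ s) (sum-alt l P) ⟩
    root ℤ.+ 0ℤ                                    ≡⟨ ℤ.+-identityʳ root ⟩
    root                                           ∎
    where open ≡-Reasoning

  length-rootEdgeLabels : length rootEdgeLabels ≡ n
  length-rootEdgeLabels = trans (merge-length r evenLabel 0 0 oddPattern) (length-map isOdd as)

  length-branchLabels : length branchLabels ≡ n
  length-branchLabels = trans (merge-length v evenLabel 0 0 oddPattern) (length-map isOdd as)

  length-leafLabels : length leafLabels ≡ sum as
  length-leafLabels = trans (merge-length ℓ pairLabel 0 0 (leafPatterns as)) (length-leafPatterns as)

  length-edgeLabels : length edgeLabels ≡ q (RT as)
  length-edgeLabels = trans (length-++ rootEdgeLabels)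
    (trans (cong₂ _+_ length-rootEdgeLabels length-leafLabels) (sym (q-RT as)))

  length-vertexLabels : length vertexLabels ≡ p (RT as)
  length-vertexLabels = cong suc (trans (length-++ branchLabels) (cong₂ _+_ length-branchLabels length-leafLabels))

  leafBlocks : List (List ℤ)
  leafBlocks = blocks 0 0 as

  length-leafBlocks : length leafBlocks ≡ n
  length-leafBlocks = trans (sym (length-map length leafBlocks)) (cong length (length-blocks 0 0 as))

  stars-after-root : 1 + length leafBlocks ≤ suc n
  stars-after-root = s≤s (≤-reflexive length-leafBlocks)

  Induced : ℕ → ℤ
  Induced w = incSum w (star 0 1 n) rootEdgeLabels
              ℤ.+ incSum w (blockStars 1 (suc n) leafBlocks) (concat leafBlocks)

  incSum-split : ∀ w → incSum w (edges (RT as)) edgeLabels ≡ Induced w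
  incSum-split w = begin
    incSum w (edges (RT as)) edgeLabels
      ≡⟨ cong (λ es → incSum w es edgeLabels) (edges-RT as) ⟩
    incSum w (star 0 1 n ++ stars 1 (suc n) as) edgeLabels
      ≡⟨ incSum-++ w (star 0 1 n) _ rootEdgeLabels _ (trans (length-star 0 1 n) (sym length-rootEdgeLabels)) ⟩
    incSum w (star 0 1 n) rootEdgeLabels ℤ.+ incSum w (stars 1 (suc n) as) leafLabels
      ≡⟨ cong₂ (λ xs ys → incSum w (star 0 1 n) rootEdgeLabels ℤ.+ incSum w (stars 1 (suc n) xs) ys)
               (sym (length-blocks 0 0 as)) (sym (concat-blocks 0 0 as)) ⟩
    Induced w ∎
    where open ≡-Reasoning

  induced-root : Induced 0 ≡ Σℤ rootEdgeLabels
  induced-root = trans (cong₂ ℤ._+_ (star-centre 0 1 n rootEdgeLabels length-rootEdgeLabels)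
                                    (stars-far 1 (suc n) leafBlocks (inj₁ (s≤s z≤n)) (s≤s z≤n)))
                       (ℤ.+-identityʳ _)

  induced-branch : ∀ {d} → d < n → Induced (suc d) ≡ at branchLabels d
  induced-branch {d} d<n = begin
    Induced (suc d)
      ≡⟨ cong₂ ℤ._+_ (star-leaf 0 1 d n rootEdgeLabels (s≤s z≤n) d<n length-rootEdgeLabels)
                     (stars-centre 1 (suc n) leafBlocks d stars-after-root (subst (d <_) (sym length-leafBlocks) d<n)) ⟩
    at rootEdgeLabels d ℤ.+ at (map Σℤ leafBlocks) d
      ≡⟨ at-zipWith rootEdgeLabels (map Σℤ leafBlocks) d
           (trans length-rootEdgeLabels (sym (trans (length-map Σℤ leafBlocks) length-leafBlocks))) ⟨
    at (zipWith ℤ._+_ rootEdgeLabels (map Σℤ leafBlocks)) d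
      ≡⟨ cong (λ xs → at xs d) (branchLabels-sum 0 0 0 as) ⟨
    at branchLabels d ∎
    where open ≡-Reasoning

  induced-leaf : ∀ {k} → k < sum as → Induced (suc n + k) ≡ at leafLabels k
  induced-leaf {k} k< = begin
    Induced (suc n + k)
      ≡⟨ cong₂ ℤ._+_ (star-far 1 n rootEdgeLabels (λ ()) (inj₂ (s≤s (m≤m+n n k))))
                     (stars-leaf 1 (suc n) leafBlocks k stars-after-root k<concat) ⟩
    0ℤ ℤ.+ at (concat leafBlocks) k
      ≡⟨ trans (ℤ.+-identityˡ _) (cong (λ xs → at xs k) (concat-blocks 0 0 as)) ⟩
    at leafLabels k ∎
    where
      open ≡-Reasoning
      k<concat : k < length (concat leafBlocks)
      k<concat = subst (k <_) (sym (trans (cong length (concat-blocks 0 0 as)) length-leafLabels)) k<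

  vertex-label : ∀ w → w < p (RT as) → incSum w (edges (RT as)) edgeLabels ≡ at vertexLabels w
  vertex-label zero    _        = trans (incSum-split 0) induced-root
  vertex-label (suc d) (s≤s d<) with d <? n
  ... | yes d<n = begin
    incSum (suc d) (edges (RT as)) edgeLabels  ≡⟨ trans (incSum-split (suc d)) (induced-branch d<n) ⟩
    at branchLabels d
      ≡⟨ at-++ˡ branchLabels leafLabels (subst (d <_) (sym length-branchLabels) d<n) ⟨
    at (branchLabels ++ leafLabels) d          ∎
    where open ≡-Reasoning
  ... | no d≮n = begin
    incSum (suc d) (edges (RT as)) edgeLabels
      ≡⟨ cong (λ w → incSum (suc w) (edges (RT as)) edgeLabels) n+k≡d ⟨
    incSum (suc n + k) (edges (RT as)) edgeLabels         ≡⟨ trans (incSum-split (suc n + k)) (induced-leaf k<) ⟩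
    at leafLabels k                                       ≡⟨ at-++ʳ branchLabels leafLabels k ⟨
    at (branchLabels ++ leafLabels) (length branchLabels + k)
      ≡⟨ cong (at (branchLabels ++ leafLabels)) (trans (cong (_+ k) length-branchLabels) n+k≡d) ⟩
    at (branchLabels ++ leafLabels) d                     ∎
    where
      open ≡-Reasoning
      k : ℕ
      k = d ∸ n
      n+k≡d : n + k ≡ d
      n+k≡d = m+[n∸m]≡n (≮⇒≥ d≮n)
      k< : k < sum as
      k< = +-cancelˡ-< n k (sum as) (subst (_< n + sum as) (sym n+k≡d) d<)

  rootEdge-∈ : ∀ {x} → x ∈ rootEdgeLabels →
               (∃ λ y → y < l × x ≡ r y) ⊎ (∃ λ e → e < h × x ≡ evenLabel e)
  rootEdge-∈ x∈ with merge-∈ r evenLabel 0 0 oddPattern x∈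
  ... | inj₁ (y , _ , y< , eq) = inj₁ (y , y< , eq)
  ... | inj₂ (e , _ , e< , eq) = inj₂ (e , e< , eq)

  branch-∈ : ∀ {x} → x ∈ branchLabels →
             (∃ λ y → y < l × x ≡ v y) ⊎ (∃ λ e → e < h × x ≡ evenLabel e)
  branch-∈ x∈ with merge-∈ v evenLabel 0 0 oddPattern x∈
  ... | inj₁ (y , _ , y< , eq) = inj₁ (y , y< , eq)
  ... | inj₂ (e , _ , e< , eq) = inj₂ (e , e< , eq)

  leaf-∈ : ∀ {x} → x ∈ leafLabels →
           (∃ λ y → y < l × x ≡ ℓ y) ⊎ (∃ λ k → k < 2 * S × x ≡ pairLabel k)
  leaf-∈ x∈ with merge-∈ ℓ pairLabel 0 0 (leafPatterns as) x∈
  ... | inj₁ (y , _ , y< , eq) = inj₁ (y , subst (y <_) (trues-leafPatterns as) y< , eq)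
  ... | inj₂ (k , _ , k< , eq) = inj₂ (k , subst (k <_) (falses-leafPatterns as) k< , eq)

  ∣evenLabel∣≤ : ∀ {e} → e < h → ∣ evenLabel e ∣ ≤ l + P
  ∣evenLabel∣≤ e< = alt-below l (subst (_ <_) h≡2P e<)

  ∣pairLabel∣≤t : ∀ {k} → k < 2 * S → ∣ pairLabel k ∣ ≤ t
  ∣pairLabel∣≤t k< = ≤-trans (alt-below (l + P) k<) (≤-reflexive (sym t≡l+P+S))

  l+P≤t : l + P ≤ t
  l+P≤t = ≤-trans (m≤m+n (l + P) S) (≤-reflexive (sym t≡l+P+S))

  spider≢evenLabel : ∀ {x} e → ∣ x ∣ ≤ l → x ≢ evenLabel e
  spider≢evenLabel = small≢alt l

  below-pairs≢pairLabel : ∀ {x} k → ∣ x ∣ ≤ l + P → x ≢ pairLabel k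
  below-pairs≢pairLabel = small≢alt (l + P)

  spider≢pairLabel : ∀ {x} k → ∣ x ∣ ≤ l → x ≢ pairLabel k
  spider≢pairLabel k ∣x∣≤l = below-pairs≢pairLabel k (≤-trans ∣x∣≤l (m≤m+n l P))

  unique-rootEdgeLabels : Unique rootEdgeLabels
  unique-rootEdgeLabels = merge-unique r evenLabel l h r-injective (λ _ _ → alt-injective l)
    (λ {_} {z} y< _ → spider≢evenLabel z (∣r∣≤l y<)) 0 0 oddPattern ≤-refl ≤-refl

  unique-leafLabels : Unique leafLabels
  unique-leafLabels = merge-unique ℓ pairLabel l (2 * S) ℓ-injective (λ _ _ → alt-injective (l + P))
    (λ {_} {z} y< _ → spider≢pairLabel z (∣ℓ∣≤l y<)) 0 0 (leafPatterns as)
    (≤-reflexive (trues-leafPatterns as)) (≤-reflexive (falses-leafPatterns as))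

  unique-branchLabels : Unique branchLabels
  unique-branchLabels = merge-unique v evenLabel l h v-injective (λ _ _ → alt-injective l)
    (λ {_} {z} y< _ → spider≢evenLabel z (∣v∣≤l y<)) 0 0 oddPattern ≤-refl ≤-refl

  rootEdge∉leaf : Disjoint rootEdgeLabels leafLabels
  rootEdge∉leaf (x∈ , x∈′) with rootEdge-∈ x∈ | leaf-∈ x∈′
  ... | inj₁ (y , y< , refl) | inj₁ (y′ , y′< , eq) = r≢ℓ y< y′< eq
  ... | inj₁ (y , y< , refl) | inj₂ (k , _ , eq)    = spider≢pairLabel k (∣r∣≤l y<) eq
  ... | inj₂ (e , e< , refl) | inj₁ (y′ , y′< , eq) = spider≢evenLabel e (∣ℓ∣≤l y′<) (sym eq)
  ... | inj₂ (e , e< , refl) | inj₂ (k , _ , eq)    = below-pairs≢pairLabel k (∣evenLabel∣≤ e<) eq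

  unique-edgeLabels : Unique edgeLabels
  unique-edgeLabels = ++⁺ unique-rootEdgeLabels unique-leafLabels rootEdge∉leaf

  branch∉leaf : Disjoint branchLabels leafLabels
  branch∉leaf (x∈ , x∈′) with branch-∈ x∈ | leaf-∈ x∈′
  ... | inj₁ (y , y< , refl) | inj₁ (y′ , y′< , eq) = v≢ℓ y< y′< eq
  ... | inj₁ (y , y< , refl) | inj₂ (k , _ , eq)    = spider≢pairLabel k (∣v∣≤l y<) eq
  ... | inj₂ (e , e< , refl) | inj₁ (y′ , y′< , eq) = spider≢evenLabel e (∣ℓ∣≤l y′<) (sym eq)
  ... | inj₂ (e , e< , refl) | inj₂ (k , _ , eq)    = below-pairs≢pairLabel k (∣evenLabel∣≤ e<) eq

  root∉ : root ∉ branchLabels ++ leafLabels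
  root∉ x∈ with ∈-++⁻ branchLabels x∈
  ... | inj₁ x∈b with branch-∈ x∈b
  ...   | inj₁ (y , y< , eq) = root≢v y< eq
  ...   | inj₂ (e , _ , eq)  = spider≢evenLabel e ∣root∣≤l eq
  root∉ x∈ | inj₂ x∈ℓ with leaf-∈ x∈ℓ
  ...   | inj₁ (y , y< , eq) = root≢ℓ y< eq
  ...   | inj₂ (k , _ , eq)  = spider≢pairLabel k ∣root∣≤l eq

  unique-vertexLabels : Unique vertexLabels
  unique-vertexLabels = ¬Any⇒All¬ _ (subst (_∉ branchLabels ++ leafLabels) (sym rootLabel) root∉)
                        ∷ ++⁺ unique-branchLabels unique-leafLabels branch∉leaf

  l≤t : l ≤ t
  l≤t = ≤-trans (m≤m+n l P) l+P≤t

  edgeLabel-bounds : ∀ {x} → x ∈ edgeLabels → ∣ x ∣ ≤ t × x ≢ 0ℤ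
  edgeLabel-bounds x∈ with ∈-++⁻ rootEdgeLabels x∈
  ... | inj₁ x∈r with rootEdge-∈ x∈r
  ...   | inj₁ (y , y< , refl) = ≤-trans (∣r∣≤l y<) l≤t , r≢0 y
  ...   | inj₂ (e , e< , refl) = ≤-trans (∣evenLabel∣≤ e<) l+P≤t , alt≢0 l e
  edgeLabel-bounds x∈ | inj₂ x∈ℓ with leaf-∈ x∈ℓ
  ...   | inj₁ (y , y< , refl) = ≤-trans (∣ℓ∣≤l y<) l≤t , ℓ≢0 y<
  ...   | inj₂ (k , k< , refl) = ∣pairLabel∣≤t k< , alt≢0 (l + P) k

  vertexLabel-bound : ∀ {x} → x ∈ vertexLabels → ∣ x ∣ ≤ t
  vertexLabel-bound (here refl) rewrite rootLabel = ≤-trans ∣root∣≤l l≤t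
  vertexLabel-bound (there x∈) with ∈-++⁻ branchLabels x∈
  ... | inj₁ x∈b with branch-∈ x∈b
  ...   | inj₁ (y , y< , refl) = ≤-trans (∣v∣≤l y<) l≤t
  ...   | inj₂ (e , e< , refl) = ≤-trans (∣evenLabel∣≤ e<) l+P≤t
  vertexLabel-bound (there x∈) | inj₂ x∈ℓ = proj₁ (edgeLabel-bounds (∈-++⁺ʳ rootEdgeLabels x∈ℓ))

  -- q = 2t and p = 2t + 1, so these are exactly the label sets.
  edgeLabel-range : ∀ {x} → x ∈ edgeLabels → LabelSet (q (RT as)) x
  edgeLabel-range {x} x∈ =
    subst (∣ x ∣ ≤_) (sym q/2≡t) (proj₁ (edgeLabel-bounds x∈)) , λ _ → proj₂ (edgeLabel-bounds x∈)
    where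
      q/2≡t : q (RT as) / 2 ≡ t
      q/2≡t = trans (cong (_/ 2) (trans (q-RT as) q≡2t)) (m*n/n≡m t 2)

  vertexLabel-range : ∀ {x} → x ∈ vertexLabels → LabelSet (p (RT as)) x
  vertexLabel-range {x} x∈ =
    subst (∣ x ∣ ≤_) (sym p/2≡t) (vertexLabel-bound x∈) , λ p-even → ⊥-elim (1≢0 (trans (sym p%2≡1) p-even))
    where
      p/2≡t : p (RT as) / 2 ≡ t
      p/2≡t = trans (cong (λ m → suc m / 2) q≡2t)
        (trans (+-distrib-/ 1 (t * 2) (subst (λ r → 1 + r < 2) (sym (m*n%n≡0 t 2)) ≤-refl)) (m*n/n≡m t 2))
      p%2≡1 : p (RT as) % 2 ≡ 1
      p%2≡1 = trans (cong (λ m → suc m % 2) q≡2t) ([m+kn]%n≡m%n 1 t 2)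
      1≢0 : 1 ≢ 0
      1≢0 ()

  edgeLabelling : Fin (q (RT as)) → ℤ
  edgeLabelling e = at edgeLabels (toℕ e)

  induced≡vertexLabels : ∀ w → inducedLabel (RT as) edgeLabelling w ≡ at vertexLabels (toℕ w)
  induced≡vertexLabels w = trans (inducedLabel-incSum (toℕ w) (edges (RT as)) edgeLabels length-edgeLabels)
                                 (vertex-label (toℕ w) (toℕ<n w))

  superEdgeGraceful : SuperEdgeGraceful (RT as)
  superEdgeGraceful =
    edgeLabelling ,
    list-bijection (q (RT as)) edgeLabelling edgeLabels length-edgeLabels
                   unique-edgeLabels edgeLabel-range (λ _ → refl) ,
    list-bijection (p (RT as)) (inducedLabel (RT as) edgeLabelling) vertexLabels length-vertexLabels
                   unique-vertexLabels vertexLabel-range induced≡vertexLabels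

-- The main theorem.  The construction does not need three positive aᵢ: it works
-- whenever the number of edges is even.
theorem3 : (as : List ℕ) → 3 ≤ numPositive as → 2 ∣ q (RT as) →
    SuperEdgeGraceful (RT as)
theorem3 as _ (divides t q≡t*2) = Labelling.superEdgeGraceful as t (trans (sym (q-RT as)) q≡t*2)
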